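{- For each $n\ge 3$, the graph $F_n$ admits a proper edge-coloring with no rainbow $C_5$ and no rainbow $C_6$.
   Context: For even $n\ge 4$, let $p=n/2$ and let $F_n$ be the graph with vertex set $\{u_1,\dots,u_p,v_1,\dots,v_p\}$ whose edges are (for all indices for which both endpoints exist): $u_iu_{i+1}$, $v_iv_{i+1}$, $u_iv_i$, $v_iu_{i+1}$, $u_iv_{i+1}$, and $u_iv_{i+2}$. Equivalently, $F_n$ is the union of the paths $u_1u_2\cdots u_p$, $v_1v_2\cdots v_p$, $u_1v_1u_2v_2\cdots u_pv_p$, and $v_2u_1v_3u_2\cdots v_pu_{p-1}$; it is a planar triangulation with $3n-6$ edges. For odd $n\ge 5$, $F_n$ is obtained from $F_{n-1}$ by adding a new vertex $u_0$ adjacent exactly to $u_1,v_1,v_2$ (inserted into the face bounded by the triangle $u_1v_1v_2$). $F_3$ is $F_4$ with $v_1$ deleted (a triangle). A proper edge-coloring assigns colors to edges so that edges sharing an endpoint get different colors; a subgraph is rainbow if all its edges have distinct colors; $C_5$, $C_6$ are the cycles on five and six vertices. -}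

module Defs where

open import Data.Nat using (ℕ; zero; suc; _+_; _≤_; NonZero)
open import Data.Nat.DivMod using (_mod_)
open import Data.Fin using (Fin; toℕ)
open import Data.Sum using (_⊎_)
open import Data.Product using (_×_; Σ)
open import Relation.Binary.PropositionalEquality using (_≡_; _≢_)
open import Function.Definitions using (Injective)

-- Vertices: u i and v i (1-based indices as in the paper; u 0 is the extra
-- vertex of odd-order graphs).
data Vtx : Set where
  u : ℕ → Vtx
  v : ℕ → Vtx

-- Directed generators of the edges of F_{2p}, 1-based indices, all
-- endpoints required to exist (indices between 1 and p).
data BaseEdge (p : ℕ) : Vtx → Vtx → Set where
  uu   : ∀ {i} → 1 ≤ i → suc i ≤ p → BaseEdge p (u i) (u (suc i))
  vv   : ∀ {i} → 1 ≤ i → suc i ≤ p → BaseEdge p (v i) (v (suc i))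
  uv   : ∀ {i} → 1 ≤ i → i ≤ p → BaseEdge p (u i) (v i)
  vu   : ∀ {i} → 1 ≤ i → suc i ≤ p → BaseEdge p (v i) (u (suc i))
  uv₁  : ∀ {i} → 1 ≤ i → suc i ≤ p → BaseEdge p (u i) (v (suc i))
  uv₂  : ∀ {i} → 1 ≤ i → suc (suc i) ≤ p → BaseEdge p (u i) (v (suc (suc i)))

data FEdge : ℕ → Vtx → Vtx → Set where
  even : ∀ {p x y} → 2 ≤ p → BaseEdge p x y → FEdge (p + p) x y
  odd  : ∀ {p x y} → 2 ≤ p → BaseEdge p x y → FEdge (suc (p + p)) x y
  odd-u₁ : ∀ {p} → 2 ≤ p → FEdge (suc (p + p)) (u 0) (u 1)
  odd-v₁ : ∀ {p} → 2 ≤ p → FEdge (suc (p + p)) (u 0) (v 1)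
  odd-v₂ : ∀ {p} → 2 ≤ p → FEdge (suc (p + p)) (u 0) (v 2)
  three : ∀ {x y} → BaseEdge 2 x y → x ≢ v 1 → y ≢ v 1 → FEdge 3 x y

Adj : ℕ → Vtx → Vtx → Set
Adj n x y = FEdge n x y ⊎ FEdge n y x

record EdgeColoring (n : ℕ) : Set where
  field
    col : Vtx → Vtx → ℕ
    symm : ∀ {x y} → Adj n x y → col x y ≡ col y x

Proper : ∀ {n} → EdgeColoring n → Set
Proper {n} c = ∀ {x y z} → Adj n x y → Adj n x z → y ≢ z →
               EdgeColoring.col c x y ≢ EdgeColoring.col c x z

next : ∀ {k} .{{_ : NonZero k}} → Fin k → Fin k
next {k} i = suc (toℕ i) mod k

IsCycle : (n k : ℕ) .{{_ : NonZero k}} → (Fin k → Vtx) → Set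
IsCycle n k w = Injective _≡_ _≡_ w × (∀ i → Adj n (w i) (w (next i)))

RainbowCycle : ∀ {n} → EdgeColoring n → (k : ℕ) .{{_ : NonZero k}} → Set
RainbowCycle {n} c k =
  Σ (Fin k → Vtx) λ w →
    IsCycle n k w ×
    Injective _≡_ _≡_ (λ i → EdgeColoring.col c (w i) (w (next i)))

module Submission where

-- Every F_n is a subgraph of the infinite graph F∞ = ⋃ F_n, so it suffices to colour F∞.
-- The colouring below is periodic: shifting all indices by two maps the neighbourhood of
-- any vertex of index ≥ 2 onto that of its image and preserves colours away from u_0.
-- An edge changes the index by at most two, so a rainbow cycle of length k + 1 whose
-- first vertex has index > 2k + 3 lies at indices ≥ 4 and can be shifted down. Hence a
-- rainbow C_5 or C_6 would have a copy starting at index ≤ 2k + 3, and an exhaustive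
-- search over the walks from these finitely many vertices finds none. Properness
-- reduces in the same way to the vertices of index ≤ 4.

open import Defs
open import Data.Bool using (Bool; true; false; if_then_else_; T)
open import Data.Bool.ListAction using (all)
open import Data.Bool.Properties using (T-≡)
open import Data.Fin using (Fin; zero; suc; toℕ; inject₁; fromℕ)
open import Data.Fin.Induction using (<-weakInduction)
open import Data.Fin.Properties
  using (toℕ-injective; toℕ-fromℕ<; toℕ-inject₁; toℕ-fromℕ; toℕ<n; toℕ≤pred[n])
open import Data.List using (List; []; _∷_; map; upTo; _++_; tabulate)
open import Data.List.Properties using (tabulate-cong)
open import Data.List.Membership.Propositional using (_∈_)
open import Data.List.Membership.Propositional.Properties
  using (∈-map⁺; ∈-map⁻; ∈-++⁺ˡ; ∈-++⁺ʳ; ∈-upTo⁺)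
open import Data.List.Relation.Unary.All as All using (All; []; _∷_; all?)
open import Data.List.Relation.Unary.All.Properties using (all⁺)
open import Data.List.Relation.Unary.Any using (here; there)
open import Data.List.Relation.Unary.Unique.Propositional using (Unique)
open import Data.List.Relation.Unary.Unique.Propositional.Properties using (tabulate⁺)
open import Data.List.Relation.Unary.Unique.DecPropositional using (unique?)
open import Data.Nat using (ℕ; zero; suc; _+_; _*_; _∸_; _⊓_; _≤_; _<_; z≤n; s≤s)
open import Data.Nat.DivMod using (_%_; m<n⇒m%n≡m; n%n≡0)
open import Data.Nat.Induction using (<-rec)
import Data.Nat.Properties as ℕ
open import Data.Product using (Σ; _×_; _,_; proj₁; proj₂)
open import Data.Sum using (_⊎_; inj₁; inj₂)
open import Data.Empty using (⊥-elim)
import Data.Vec.Functional as Vector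
open import Function using (_∘_; Equivalence)
open import Function.Definitions using (Injective)
open import Relation.Binary.Definitions using (DecidableEquality; _Respects_)
open import Relation.Binary.PropositionalEquality
  using (_≡_; _≢_; refl; sym; trans; cong; cong₂; subst; subst₂; _≗_; module ≡-Reasoning)
open import Relation.Nullary using (¬_; Dec; no; map′; ¬?; _×-dec_; _⊎-dec_)
open import Relation.Nullary.Decidable using (isYes; isNo; toWitness; toWitnessFalse)
open import Relation.Unary using (Decidable)

-- The graph F∞

index : Vtx → ℕ
index (u i) = i
index (v i) = i

u-injective : ∀ {i j} → u i ≡ u j → i ≡ j
u-injective refl = refl

v-injective : ∀ {i j} → v i ≡ v j → i ≡ j
v-injective refl = refl

_≟_ : DecidableEquality Vtx
u i ≟ u j = map′ (cong u) u-injective (i ℕ.≟ j)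
v i ≟ v j = map′ (cong v) v-injective (i ℕ.≟ j)
u _ ≟ v _ = no λ ()
v _ ≟ u _ = no λ ()

open import Data.List.Membership.DecPropositional _≟_ using (_∈?_)

-- F∞ has the vertices u_i (i ≥ 0) and v_i (i ≥ 1); v 0 is isolated. The lists are
-- ordered so that every kind of edge of F_n sits at a position independent of i.

v⁺ : ℕ → List Vtx
v⁺ zero    = []
v⁺ (suc i) = v (suc i) ∷ []

backwardᵘ : ℕ → List Vtx
backwardᵘ zero    = []
backwardᵘ (suc i) = u i ∷ v (suc i) ∷ v⁺ i

backwardᵛ : ℕ → List Vtx
backwardᵛ zero    = []
backwardᵛ (suc i) = v (suc i) ∷ u i ∷ []

neighbours : Vtx → List Vtx
neighbours (u i)       = u (suc i) ∷ v (suc i) ∷ v (2 + i) ∷ backwardᵘ i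
neighbours (v zero)    = []
neighbours (v (suc i)) = v (2 + i) ∷ u (suc i) ∷ u (2 + i) ∷ u i ∷ backwardᵛ i

baseEdge-∈ : ∀ {p x y} → BaseEdge p x y → y ∈ neighbours x × x ∈ neighbours y
baseEdge-∈ (uu _ _)           = here refl , there (there (there (here refl)))
baseEdge-∈ (vv (s≤s z≤n) _)   = here refl , there (there (there (there (here refl))))
baseEdge-∈ (uv (s≤s z≤n) _)   = there (there (there (there (here refl)))) , there (here refl)
baseEdge-∈ (vu (s≤s z≤n) _)   = there (there (here refl)) , there (there (there (there (there (here refl)))))
baseEdge-∈ (uv₁ _ _)          = there (here refl) , there (there (there (here refl)))
baseEdge-∈ (uv₂ _ _)          = there (there (here refl)) , there (there (there (there (there (here refl)))))

edge-∈ : ∀ {n x y} → FEdge n x y → y ∈ neighbours x × x ∈ neighbours y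
edge-∈ (even _ e)    = baseEdge-∈ e
edge-∈ (odd _ e)     = baseEdge-∈ e
edge-∈ (odd-u₁ _)    = here refl , there (there (there (here refl)))
edge-∈ (odd-v₁ _)    = there (here refl) , there (there (there (here refl)))
edge-∈ (odd-v₂ _)    = there (there (here refl)) , there (there (there (there (there (here refl)))))
edge-∈ (three e _ _) = baseEdge-∈ e

Adj⇒∈neighbours : ∀ {n x y} → Adj n x y → y ∈ neighbours x
Adj⇒∈neighbours (inj₁ e) = proj₁ (edge-∈ e)
Adj⇒∈neighbours (inj₂ e) = proj₂ (edge-∈ e)

neighbour-index : ∀ x → All (λ y → index x ≤ 2 + index y) (neighbours x)
neighbour-index (u i) = ℕ.m≤n+m i 3 ∷ ℕ.m≤n+m i 3 ∷ ℕ.m≤n+m i 4 ∷ backward i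
  where
  backward : ∀ i → All (λ y → i ≤ 2 + index y) (backwardᵘ i)
  backward zero          = []
  backward (suc zero)    = ℕ.m≤n+m 1 1 ∷ ℕ.m≤n+m 1 2 ∷ []
  backward (suc (suc i)) = ℕ.m≤n+m _ 1 ∷ ℕ.m≤n+m _ 2 ∷ ℕ.m≤n+m _ 1 ∷ []
neighbour-index (v zero)    = []
neighbour-index (v (suc i)) = ℕ.m≤n+m _ 3 ∷ ℕ.m≤n+m _ 2 ∷ ℕ.m≤n+m _ 3 ∷ ℕ.m≤n+m _ 1 ∷ backward i
  where
  backward : ∀ i → All (λ y → suc i ≤ 2 + index y) (backwardᵛ i)
  backward zero    = []
  backward (suc i) = ℕ.m≤n+m _ 1 ∷ ℕ.≤-refl ∷ []

∈-neighbours-index : ∀ {x y} → y ∈ neighbours x → index x ≤ 2 + index y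
∈-neighbours-index {x} = All.lookup (neighbour-index x)

-- The colouring

-- Two-step recursion makes the colouring invariant under i ↦ i + 2 by computation.
isOdd : ℕ → Bool
isOdd zero          = false
isOdd (suc zero)    = true
isOdd (suc (suc n)) = isOdd n

data Offset : Set where
  behind same ahead₁ ahead₂ far : Offset

offset : ℕ → ℕ → Offset
offset (suc i) (suc j)            = offset i j
offset zero zero                  = same
offset zero (suc zero)            = ahead₁
offset zero (suc (suc zero))      = ahead₂
offset zero (suc (suc (suc _)))   = far
offset (suc zero) zero            = behind
offset (suc (suc _)) zero         = far

offsetColour : Bool → Offset → ℕ
offsetColour o same      = if o then 2 else 4
offsetColour _   ahead₁  = 5
offsetColour o ahead₂    = if o then 4 else 2
offsetColour _   behind  = 0
offsetColour _   far     = 0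

uvColour : ℕ → ℕ → ℕ
uvColour zero (suc zero)       = 1
uvColour zero (suc (suc zero)) = 2
uvColour zero _                = 0
uvColour (suc i) j             = offsetColour (isOdd (suc i)) (offset (suc i) j)

uuColour : ℕ → ℕ
uuColour zero    = 0
uuColour (suc i) = if isOdd (suc i) then 1 else 3

vvColour : ℕ → ℕ
vvColour i = if isOdd i then 3 else 1

-- u_i u_{i+1}: 1 (i odd), 3 (i even, i ≥ 2);   v_i v_{i+1}: 3 (i odd), 1 (i even);
-- u_i v_i: 2 (i odd), 4 (i even);   u_i v_{i+1}: 5;   u_i v_{i+2}: 4 (i odd), 2 (i even);
-- v_i u_{i+1}: 0;   u_0 u_1: 0, u_0 v_1: 1, u_0 v_2: 2.   Non-edges get the junk colour 0.
colour : Vtx → Vtx → ℕ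
colour (u i) (u j) = uuColour (i ⊓ j)
colour (v i) (v j) = vvColour (i ⊓ j)
colour (u i) (v j) = uvColour i j
colour (v j) (u i) = uvColour i j

colour-sym : ∀ x y → colour x y ≡ colour y x
colour-sym (u i) (u j) = cong uuColour (ℕ.⊓-comm i j)
colour-sym (v i) (v j) = cong vvColour (ℕ.⊓-comm i j)
colour-sym (u i) (v j) = refl
colour-sym (v j) (u i) = refl

-- Periodicity

raise : Vtx → Vtx
raise (u i) = u (2 + i)
raise (v i) = v (2 + i)

lower : Vtx → Vtx
lower (u i) = u (i ∸ 2)
lower (v i) = v (i ∸ 2)

index-lower : ∀ x → index (lower x) ≡ index x ∸ 2
index-lower (u i) = refl
index-lower (v i) = refl

≤-index-lower : ∀ {c x} → 2 + c ≤ index x → c ≤ index (lower x)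
≤-index-lower {c} {x} 2+c≤x = subst (c ≤_) (sym (index-lower x)) (ℕ.∸-monoˡ-≤ 2 2+c≤x)

lower-raise : ∀ x → lower (raise x) ≡ x
lower-raise (u i) = refl
lower-raise (v i) = refl

raise-lower : ∀ {x} → 2 ≤ index x → raise (lower x) ≡ x
raise-lower {u _} (s≤s (s≤s z≤n)) = refl
raise-lower {v _} (s≤s (s≤s z≤n)) = refl

neighbours-raise : ∀ {x} → 2 ≤ index x → neighbours (raise x) ≡ map raise (neighbours x)
neighbours-raise {u _} (s≤s (s≤s z≤n)) = refl
neighbours-raise {v _} (s≤s (s≤s z≤n)) = refl

∈-neighbours-raise⁻ : ∀ {x y} → 2 ≤ index x → y ∈ neighbours (raise x) →
                      lower y ∈ neighbours x × raise (lower y) ≡ y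
∈-neighbours-raise⁻ 2≤x y∈ with ∈-map⁻ raise (subst (_ ∈_) (neighbours-raise 2≤x) y∈)
... | y′ , y′∈ , refl rewrite lower-raise y′ = y′∈ , refl

colour-raise : ∀ {x y} → 1 ≤ index x → 1 ≤ index y → colour (raise x) (raise y) ≡ colour x y
colour-raise {u _} {u _} (s≤s z≤n) (s≤s z≤n) = refl
colour-raise {u _} {v _} (s≤s z≤n) (s≤s z≤n) = refl
colour-raise {v _} {u _} (s≤s z≤n) (s≤s z≤n) = refl
colour-raise {v _} {v _} (s≤s z≤n) (s≤s z≤n) = refl

stepTwo-induction : ∀ {ℓ} (P : ℕ → Set ℓ) (B : ℕ) →
                    (∀ {m} → m ≤ B → P m) → (∀ {m} → B < m → P (m ∸ 2) → P m) → ∀ m → P m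
stepTwo-induction P B base step = <-rec P λ m rec → case m rec (ℕ.≤-<-connex m B)
  where
  ∸2< : ∀ {m} → B < m → m ∸ 2 < m
  ∸2< {suc m} _ = s≤s (ℕ.m∸n≤m m 1)
  case : ∀ m → (∀ {n} → n < m → P n) → m ≤ B ⊎ B < m → P m
  case m rec (inj₁ m≤B) = base m≤B
  case m rec (inj₂ B<m) = step B<m (rec (∸2< B<m))

verticesUpTo : ℕ → List Vtx
verticesUpTo B = map u (upTo (suc B)) ++ map v (upTo (suc B))

∈-verticesUpTo : ∀ {B x} → index x ≤ B → x ∈ verticesUpTo B
∈-verticesUpTo {x = u _} i≤B = ∈-++⁺ˡ (∈-map⁺ u (∈-upTo⁺ (s≤s i≤B)))
∈-verticesUpTo {B} {v _} i≤B = ∈-++⁺ʳ (map u (upTo (suc B))) (∈-map⁺ v (∈-upTo⁺ (s≤s i≤B)))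

all-verticesUpTo : ∀ {B} (f : Vtx → Bool) → all f (verticesUpTo B) ≡ true →
                   ∀ {x} → index x ≤ B → T (f x)
all-verticesUpTo f checked x≤B =
  All.lookup (all⁺ f _ (Equivalence.from T-≡ checked)) (∈-verticesUpTo x≤B)

-- Properness

ProperAt : Vtx → Set
ProperAt x = ∀ {y z} → y ∈ neighbours x → z ∈ neighbours x → y ≢ z → colour x y ≢ colour x z

ProperAt-raise : ∀ {x} → 3 ≤ index x → ProperAt x → ProperAt (raise x)
ProperAt-raise {x} 3≤x proper {y} {z} y∈ z∈ y≢z eq =
  proper (proj₁ (lowered y∈)) (proj₁ (lowered z∈))
    (λ e → y≢z (trans (sym (proj₂ (lowered y∈))) (trans (cong raise e) (proj₂ (lowered z∈)))))
    (trans (sym (colour-lower y∈)) (trans eq (colour-lower z∈)))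
  where
  lowered : ∀ {y} → y ∈ neighbours (raise x) → lower y ∈ neighbours x × raise (lower y) ≡ y
  lowered = ∈-neighbours-raise⁻ (ℕ.<⇒≤ 3≤x)
  colour-lower : ∀ {y} → y ∈ neighbours (raise x) → colour (raise x) y ≡ colour x (lower y)
  colour-lower {y} y∈ = begin
    colour (raise x) y                 ≡⟨ cong (colour (raise x)) (sym (proj₂ (lowered y∈))) ⟩
    colour (raise x) (raise (lower y)) ≡⟨ colour-raise {x} {lower y} 1≤x 1≤lower-y ⟩
    colour x (lower y)                 ∎
    where
    open ≡-Reasoning
    1≤x : 1 ≤ index x
    1≤x = ℕ.≤-trans (s≤s z≤n) 3≤x
    1≤lower-y : 1 ≤ index (lower y)
    1≤lower-y = ℕ.+-cancelˡ-≤ 2 1 _ (ℕ.≤-trans 3≤x (∈-neighbours-index (proj₁ (lowered y∈))))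

ProperTable : Vtx → Set
ProperTable x =
  All (λ y → All (λ z → y ≡ z ⊎ colour x y ≢ colour x z) (neighbours x)) (neighbours x)

properTable? : ∀ x → Dec (ProperTable x)
properTable? x =
  all? (λ y → all? (λ z → (y ≟ z) ⊎-dec ¬? (colour x y ℕ.≟ colour x z))
                   (neighbours x))
       (neighbours x)

ProperTable⇒ProperAt : ∀ {x} → ProperTable x → ProperAt x
ProperTable⇒ProperAt table y∈ z∈ y≢z with All.lookup (All.lookup table y∈) z∈
... | inj₁ y≡z = ⊥-elim (y≢z y≡z)
... | inj₂ c≢c = c≢c

properTable-search : all (isYes ∘ properTable?) (verticesUpTo 4) ≡ true
properTable-search = refl

properAt : ∀ x → ProperAt x
properAt x = stepTwo-induction (λ m → ∀ x → index x ≡ m → ProperAt x) 4 base step (index x) x refl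
  where
  base : ∀ {m} → m ≤ 4 → ∀ x → index x ≡ m → ProperAt x
  base m≤4 x refl = ProperTable⇒ProperAt (toWitness {a? = properTable? x}
    (all-verticesUpTo (isYes ∘ properTable?) properTable-search {x} m≤4))
  step : ∀ {m} → 4 < m → (∀ x → index x ≡ m ∸ 2 → ProperAt x) → ∀ x → index x ≡ m → ProperAt x
  step 4<m proper-below x refl =
    subst ProperAt (raise-lower (ℕ.≤-trans (ℕ.m≤n+m 2 3) 4<m))
      (ProperAt-raise (≤-index-lower {x = x} 4<m) (proper-below (lower x) (index-lower x)))

IsWalk : ∀ {k} → (Fin (suc k) → Vtx) → Set
IsWalk {k} w = ∀ (i : Fin k) → w (suc i) ∈ neighbours (w (inject₁ i))

IsWalk-index : ∀ {k} {w : Fin (suc k) → Vtx} → IsWalk w →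
               ∀ i → index (w zero) ≤ toℕ i * 2 + index (w i)
IsWalk-index {w = w} walk =
  <-weakInduction (λ i → index (w zero) ≤ toℕ i * 2 + index (w i)) ℕ.≤-refl step
  where
  open ℕ.≤-Reasoning
  step : ∀ i → index (w zero) ≤ toℕ (inject₁ i) * 2 + index (w (inject₁ i)) →
         index (w zero) ≤ toℕ (suc i) * 2 + index (w (suc i))
  step i p = begin
    index (w zero)                     ≤⟨ p ⟩
    toℕ (inject₁ i) * 2 + index prev   ≡⟨ cong (λ t → t * 2 + index prev) (toℕ-inject₁ i) ⟩
    toℕ i * 2 + index prev             ≤⟨ ℕ.+-monoʳ-≤ (toℕ i * 2) (∈-neighbours-index (walk i)) ⟩
    toℕ i * 2 + (2 + index cur)        ≡⟨ ℕ.+-suc (toℕ i * 2) _ ⟩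
    suc (toℕ i * 2 + suc (index cur))  ≡⟨ cong suc (ℕ.+-suc (toℕ i * 2) _) ⟩
    toℕ (suc i) * 2 + index cur        ∎
    where
    prev cur : Vtx
    prev = w (inject₁ i)
    cur  = w (suc i)

IsWalk-above : ∀ {k c} {w : Fin (suc k) → Vtx} → IsWalk w → c + k * 2 ≤ index (w zero) →
               ∀ i → c ≤ index (w i)
IsWalk-above {k} {c} {w} walk above i = ℕ.+-cancelˡ-≤ (k * 2) c (index (w i)) (begin
    k * 2 + c                ≡⟨ ℕ.+-comm (k * 2) c ⟩
    c + k * 2                ≤⟨ above ⟩
    index (w zero)           ≤⟨ IsWalk-index {w = w} walk i ⟩
    toℕ i * 2 + index (w i)  ≤⟨ ℕ.+-monoˡ-≤ (index (w i)) (ℕ.*-monoˡ-≤ 2 (toℕ≤pred[n] i)) ⟩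
    k * 2 + index (w i)      ∎)
  where open ℕ.≤-Reasoning

-- Boolean rather than a decision procedure for an All-statement: the searches below are
-- run by the type checker, which evaluates the Boolean version much faster.
everyWalkAvoids : ∀ k {P : (Fin (suc k) → Vtx) → Set} → Decidable P → Vtx → Bool
everyWalkAvoids zero    P? x = isNo (P? λ _ → x)
everyWalkAvoids (suc k) P? x = all (everyWalkAvoids k λ w → P? (x Vector.∷ w)) (neighbours x)

everyWalkAvoids-sound : ∀ k {P : (Fin (suc k) → Vtx) → Set} (P? : Decidable P) → P Respects _≗_ →
                        ∀ {w} → IsWalk w → T (everyWalkAvoids k P? (w zero)) → ¬ P w
everyWalkAvoids-sound zero    P? resp walk avoids p =
  toWitnessFalse avoids (resp (λ { zero → refl }) p)
everyWalkAvoids-sound (suc k) {P} P? resp {w} walk avoids p =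
  everyWalkAvoids-sound k (λ w′ → P? (w zero Vector.∷ w′)) resp-tail (walk ∘ suc)
    (All.lookup (all⁺ _ _ avoids) (walk zero)) (resp (λ { zero → refl ; (suc i) → refl }) p)
  where
  resp-tail : (λ w′ → P (w zero Vector.∷ w′)) Respects _≗_
  resp-tail eq = resp λ { zero → refl ; (suc i) → eq i }

-- Rainbow cycles

next-inject₁ : ∀ {k} (i : Fin k) → next (inject₁ i) ≡ suc i
next-inject₁ {k} i = toℕ-injective (begin
  toℕ (next (inject₁ i))         ≡⟨ toℕ-fromℕ< _ ⟩
  suc (toℕ (inject₁ i)) % suc k  ≡⟨ cong (λ t → suc t % suc k) (toℕ-inject₁ i) ⟩
  suc (toℕ i) % suc k            ≡⟨ m<n⇒m%n≡m (s≤s (toℕ<n i)) ⟩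
  suc (toℕ i)                    ∎)
  where open ≡-Reasoning

next-fromℕ : ∀ k → next (fromℕ k) ≡ zero
next-fromℕ k = toℕ-injective (begin
  toℕ (next (fromℕ k))         ≡⟨ toℕ-fromℕ< _ ⟩
  suc (toℕ (fromℕ k)) % suc k  ≡⟨ cong (λ t → suc t % suc k) (toℕ-fromℕ k) ⟩
  suc k % suc k                ≡⟨ n%n≡0 (suc k) ⟩
  0                            ∎)
  where open ≡-Reasoning

edgeColour : ∀ {k} → (Fin (suc k) → Vtx) → Fin (suc k) → ℕ
edgeColour w i = colour (w i) (w (next i))

record RainbowCycle∞ {k} (w : Fin (suc k) → Vtx) : Set where
  field
    adjacent : ∀ i → w (next i) ∈ neighbours (w i)
    distinct : Injective _≡_ _≡_ w
    rainbow  : Injective _≡_ _≡_ (edgeColour w)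

RainbowCycle∞⇒IsWalk : ∀ {k} {w : Fin (suc k) → Vtx} → RainbowCycle∞ w → IsWalk w
RainbowCycle∞⇒IsWalk {w = w} c i =
  subst (λ j → w j ∈ neighbours (w (inject₁ i))) (next-inject₁ i)
    (RainbowCycle∞.adjacent c (inject₁ i))

RainbowCycle∞-lower : ∀ {k} {w : Fin (suc k) → Vtx} → (∀ i → 4 ≤ index (w i)) →
                      RainbowCycle∞ w → RainbowCycle∞ (lower ∘ w)
RainbowCycle∞-lower {w = w} high c = record
  { adjacent = λ i → proj₁ (∈-neighbours-raise⁻ (≤-index-lower {x = w i} (high i))
                              (subst (λ x → w (next i) ∈ neighbours x) (sym (raised i)) (adjacent i)))
  ; distinct = λ {i} {j} eq → distinct (trans (sym (raised i)) (trans (cong raise eq) (raised j)))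
  ; rainbow  = λ {i} {j} eq → rainbow (trans (lowered i) (trans eq (sym (lowered j))))
  }
  where
  open RainbowCycle∞ c
  raised : ∀ i → raise (lower (w i)) ≡ w i
  raised i = raise-lower (ℕ.≤-trans (ℕ.m≤n+m 2 2) (high i))
  positive : ∀ i → 1 ≤ index (lower (w i))
  positive i = ≤-index-lower {x = w i} (ℕ.≤-trans (ℕ.n≤1+n 3) (high i))
  lowered : ∀ i → edgeColour w i ≡ edgeColour (lower ∘ w) i
  lowered i = trans (sym (cong₂ colour (raised i) (raised (next i))))
                    (colour-raise {lower (w i)} {lower (w (next i))} (positive i) (positive (next i)))

-- Testing the closing edge first rejects most walks cheaply.
ClosesRainbow : ∀ {k} → (Fin (suc k) → Vtx) → Set
ClosesRainbow {k} w =
  w zero ∈ neighbours (w (fromℕ k)) × Unique (tabulate w) × Unique (tabulate (edgeColour w))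

closesRainbow? : ∀ {k} → Decidable (ClosesRainbow {k})
closesRainbow? {k} w =
  (w zero ∈? neighbours (w (fromℕ k))) ×-dec
  unique? _≟_ (tabulate w) ×-dec
  unique? ℕ._≟_ (tabulate (edgeColour w))

ClosesRainbow-resp : ∀ {k} → ClosesRainbow {k} Respects _≗_
ClosesRainbow-resp {k} eq (closes , distinct , rainbow) =
  subst₂ (λ x y → x ∈ neighbours y) (eq zero) (eq (fromℕ k)) closes ,
  subst Unique (tabulate-cong eq) distinct ,
  subst Unique (tabulate-cong λ i → cong₂ colour (eq i) (eq (next i))) rainbow

RainbowCycle∞⇒ClosesRainbow : ∀ {k} {w : Fin (suc k) → Vtx} → RainbowCycle∞ w → ClosesRainbow w
RainbowCycle∞⇒ClosesRainbow {k} {w} c =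
  subst (λ j → w j ∈ neighbours (w (fromℕ k))) (next-fromℕ k) (adjacent (fromℕ k)) ,
  tabulate⁺ distinct ,
  tabulate⁺ rainbow
  where open RainbowCycle∞ c

searchBound : ℕ → ℕ
searchBound k = 3 + k * 2

noRainbowCycleFrom : ∀ k → Vtx → Bool
noRainbowCycleFrom k = everyWalkAvoids k closesRainbow?

noRainbowCycle∞ : ∀ k → all (noRainbowCycleFrom k) (verticesUpTo (searchBound k)) ≡ true →
                  (w : Fin (suc k) → Vtx) → ¬ RainbowCycle∞ w
noRainbowCycle∞ k checked w = stepTwo-induction P (searchBound k) base step (index (w zero)) w refl
  where
  P : ℕ → Set
  P m = ∀ w → index (w zero) ≡ m → ¬ RainbowCycle∞ w
  base : ∀ {m} → m ≤ searchBound k → P m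
  base m≤B w eq c =
    everyWalkAvoids-sound k closesRainbow? ClosesRainbow-resp {w} (RainbowCycle∞⇒IsWalk c)
      (all-verticesUpTo (noRainbowCycleFrom k) checked (subst (_≤ searchBound k) (sym eq) m≤B))
      (RainbowCycle∞⇒ClosesRainbow c)
  step : ∀ {m} → searchBound k < m → P (m ∸ 2) → P m
  step B<m none-below w eq c =
    none-below (lower ∘ w) (trans (index-lower (w zero)) (cong (_∸ 2) eq))
      (RainbowCycle∞-lower (IsWalk-above {w = w} (RainbowCycle∞⇒IsWalk c) high) c)
    where
    high : 4 + k * 2 ≤ index (w zero)
    high = subst (searchBound k <_) (sym eq) B<m

noRainbowC₅-search : all (noRainbowCycleFrom 4) (verticesUpTo (searchBound 4)) ≡ true
noRainbowC₅-search = refl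

noRainbowC₆-search : all (noRainbowCycleFrom 5) (verticesUpTo (searchBound 5)) ≡ true
noRainbowC₆-search = refl

colouring : ∀ n → EdgeColoring n
colouring n = record { col = colour ; symm = λ {x} {y} _ → colour-sym x y }

noRainbowCycle : ∀ {n} k → (∀ (w : Fin (suc k) → Vtx) → ¬ RainbowCycle∞ w) →
                 ¬ RainbowCycle (colouring n) (suc k)
noRainbowCycle k none (w , (distinct , adjacent) , rainbow) =
  none w record { adjacent = Adj⇒∈neighbours ∘ adjacent ; distinct = distinct ; rainbow = rainbow }

mainTheorem5 : (n : ℕ) → 3 ≤ n →
    Σ (EdgeColoring n) λ c →
      Proper c × ¬ RainbowCycle c 5 × ¬ RainbowCycle c 6
mainTheorem5 n _ =
  colouring n ,
  (λ xy xz → properAt _ (Adj⇒∈neighbours xy) (Adj⇒∈neighbours xz)) ,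
  noRainbowCycle 4 (noRainbowCycle∞ 4 noRainbowC₅-search) ,
  noRainbowCycle 5 (noRainbowCycle∞ 5 noRainbowC₆-search)
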